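{- Assume the setting described in the context. Then the functions $g^i$, $1\le i\le m$, together with the functions $g^{x,y}$ with $0\le x\le s-r$, $x\not\equiv k_t\pmod b$ for all $t\in[r]$, and $1\le y\le\binom{n}{x}_q$, are linearly independent in $\mathbb{F}_p^{\Omega}$ over $\mathbb{F}_p$.
   Context: Setting: $V$ is an $n$-dimensional vector space over $\mathbb{F}_q$; $b$ is a positive integer; $K=\{k_1<\cdots<k_r\}$ and $L=\{\mu_1,\ldots,\mu_s\}$ are disjoint subsets of $\{0,\ldots,b-1\}$; it is not the case that ($q+1$ is a power of $2$ and $b=2$), and not the case that ($q=2$, $b=6$). $\mathcal{F}=\{V_1,\ldots,V_m\}$ is a family of subspaces of $V$ with $\dim(V_i)\equiv k_t\pmod b$ for some $k_t\in K$ for each $i$, and $\dim(V_i\cap V_j)\equiv\mu_t\pmod b$ for some $\mu_t\in L$ for each distinct $i,j$. $p$ is a prime with $q^b\equiv1\pmod p$ and $q^i\not\equiv1\pmod p$ for $0<i<b$. $\binom{a}{d}_q$ is the $q$-binomial coefficient. Fix an ordering of the subspaces of each dimension, so each subspace is $V_{d,e}$, the $e$-th subspace of dimension $d$; pairs ordered first by $d$ then $e$. Let $S=\sum_{t=0}^s\binom{n}{t}_q$, $\Omega=\mathbb{F}_2^S$ with coordinates $v^{x,y}$, $0\le x\le s$, $1\le y\le\binom{n}{x}_q$. For a subspace $W$, its containment vector $v_W$ has $v_W^{x,y}=1$ iff $V_{x,y}\subseteq W$; $v_i=v_{V_i}$. Define $f^{x,y}(v)=v^{x,y}$; for $0\le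 x\le s-r$, $g^{x,y}(v)=f^{x,y}(v)\prod_{t\in[r]}\left(\sum_{j=1}^{\binom{n}{1}_q}v^{1,j}-\binom{k_t}{1}_q\right)$; for $1\le i\le m$, $g^i(v)=\prod_{j=1}^s\left(\sum_{y=1}^{\binom{n}{1}_q}v_i^{1,y}v^{1,y}-\binom{\mu_j}{1}_q\right)$; all computed in $\mathbb{F}_p$. -}

module Defs where

open import Level using (0ℓ)
open import Data.Nat using (ℕ; zero; suc; _^_; _<_)
open import Data.Integer as ℤ using (ℤ; +_; _-_)
open import Data.Integer.Divisibility using (_∣_)
open import Data.Fin as Fin using (Fin; toℕ)
open import Data.Bool using (Bool; true; false)
open import Data.Product using (Σ; ∃; _×_; _,_)
open import Relation.Binary.PropositionalEquality using (_≡_; _≢_)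
open import Algebra.Core using (Op₁; Op₂)
import Algebra.Structures as AS

Cong : ℕ → ℕ → ℕ → Set
Cong a c m = (+ m) ∣ ((+ a) - (+ c))

Σℤ : (n : ℕ) → (Fin n → ℤ) → ℤ
Σℤ zero    f = + 0
Σℤ (suc n) f = f Fin.zero ℤ.+ Σℤ n (λ i → f (Fin.suc i))

Πℤ : (n : ℕ) → (Fin n → ℤ) → ℤ
Πℤ zero    f = + 1
Πℤ (suc n) f = f Fin.zero ℤ.* Πℤ n (λ i → f (Fin.suc i))

-- Gaussian integer [k]_q = binom(k,1)_q = 1 + q + ... + q^(k-1)
qint : ℕ → ℕ → ℕ
qint q zero    = 0
qint q (suc k) = q ^ k Data.Nat.+ qint q k

⟦_⟧ : Bool → ℤ
⟦ true ⟧  = + 1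
⟦ false ⟧ = + 0

record FiniteField (q : ℕ) : Set₁ where
  field
    Carrier : Set
    _+_ _*_ : Op₂ Carrier
    -_      : Op₁ Carrier
    0# 1#   : Carrier
    isCommutativeRing : AS.IsCommutativeRing {A = Carrier} _≡_ _+_ _*_ -_ 0# 1#
    0≢1     : 0# ≢ 1#
    inverse : ∀ x → x ≢ 0# → ∃ λ y → x * y ≡ 1#
    enum    : Fin q → Carrier
    enum-injective  : ∀ i j → enum i ≡ enum j → i ≡ j
    enum-surjective : ∀ x → ∃ λ i → enum i ≡ x

module Lin {q : ℕ} (F : FiniteField q) (n : ℕ) where
  open FiniteField F

  Vec : Set
  Vec = Fin n → Carrier

  ΣF : (d : ℕ) → (Fin d → Carrier) → Carrier
  ΣF zero    f = 0#
  ΣF (suc d) f = f Fin.zero + ΣF d (λ i → f (Fin.suc i))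

  -- a subset of V (a "subspace" when it has a dimension, see HasDim)
  Pred : Set₁
  Pred = Vec → Set

  Independent : {d : ℕ} → (Fin d → Vec) → Set
  Independent {d} β = ∀ (a : Fin d → Carrier) →
    (∀ i → ΣF d (λ j → a j * β j i) ≡ 0#) → ∀ j → a j ≡ 0#

  InSpan : {d : ℕ} → (Fin d → Vec) → Vec → Set
  InSpan {d} β w = ∃ λ (a : Fin d → Carrier) → ∀ i → w i ≡ ΣF d (λ j → a j * β j i)

  HasDim : Pred → ℕ → Set
  HasDim P d = Σ (Fin d → Vec) λ β → Independent β × (∀ w → (P w → InSpan β w) × (InSpan β w → P w))

  _∩_ : Pred → Pred → Pred
  (P ∩ Q) w = P w × Q w

  _⊆_ : Pred → Pred → Set
  P ⊆ Q = ∀ w → P w → Q w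

  _≐_ : Pred → Pred → Set
  P ≐ Q = P ⊆ Q × Q ⊆ P

  -- sub d enumerates the d-dimensional subspaces of V without repetition:
  -- the e-th subspace of dimension d is V_{d,e} = sub d e.
  IsEnumeration : (N : ℕ → ℕ) → ((d : ℕ) → Fin (N d) → Pred) → Set₁
  IsEnumeration N sub = ∀ d →
      (∀ e → HasDim (sub d e) d)
    × (∀ e e′ → sub d e ≐ sub d e′ → e ≡ e′)
    × (∀ (P : Pred) → HasDim P d → ∃ λ e → P ≐ sub d e)

-- Ω = F_2^S, coordinates v^{x,y}, 0 ≤ x ≤ s, y < N x (N x = #x-dim subspaces)
Ω : (N : ℕ → ℕ) (s : ℕ) → Set
Ω N s = (x : Fin (suc s)) → Fin (N (toℕ x)) → Bool

-- the coordinates v^{1,y} (only meaningful when s ≥ 1; for s = 0 they are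
-- never used in a nonempty product)
ones : (N : ℕ → ℕ) (s : ℕ) → Ω N s → Fin (N 1) → Bool
ones N zero    v y = false
ones N (suc s) v y = v (Fin.suc Fin.zero) y

-- g^{x,y}(v) = v^{x,y} ∏_{t∈[r]} (Σ_j v^{1,j} − [k_t]_q), as an integer (read mod p)
gxy : (q : ℕ) (N : ℕ → ℕ) (s r : ℕ) (k : Fin r → ℕ) →
      (x : Fin (suc s)) → Fin (N (toℕ x)) → Ω N s → ℤ
gxy q N s r k x y v =
  ⟦ v x y ⟧ ℤ.* Πℤ r (λ t → Σℤ (N 1) (λ j → ⟦ ones N s v j ⟧) - (+ qint q (k t)))

-- g^i(v) = ∏_{j∈[s]} (Σ_y v_i^{1,y} v^{1,y} − [μ_j]_q), as an integer (read mod p)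
gi : (q : ℕ) (N : ℕ → ℕ) (s : ℕ) (μ : Fin s → ℕ) →
     (Fin (N 1) → Bool) → Ω N s → ℤ
gi q N s μ vi v =
  Πℤ s (λ j → Σℤ (N 1) (λ y → ⟦ vi y ⟧ ℤ.* ⟦ ones N s v y ⟧) - (+ qint q (μ j)))

-- Work modulo p. Since q has multiplicative order b modulo p, the Gaussian integers
-- [a]_q = (q^a - 1)/(q - 1) satisfy [a]_q ≡ [a′]_q (mod p) exactly when a ≡ a′ (mod b)
-- (for b ≥ 2), and a d-dimensional subspace contains exactly [d]_q lines: its q^d - 1 nonzero
-- vectors fall into lines of q - 1 each.
--
-- Suppose a combination of the g^i and g^{x,y} vanishes mod p on all of Ω. At the point whose
-- level-1 coordinates form the containment vector of V_j (all other coordinates 0), every g^{x,y}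
-- vanishes (the factor for k_t ≡ dim V_j), every g^i with i ≠ j vanishes (the factor for
-- μ_t ≡ dim (V_i ∩ V_j)), and g^j does not (dim V_j ≢ μ_t); hence p ∣ c_j. Once all c_j are gone,
-- switching on a single coordinate (x, y) with x ≠ 1 on top of the containment vector of V_{x,y}
-- changes the combination by c′_{x,y} ∏_t ([x]_q - [k_t]_q); for x = 1 one evaluates at the
-- indicator of the line V_{1,y} instead. As x ≢ k_t, the product is a unit mod p.

module Submission where

open import Defs
open import Level using (0ℓ)
open import Function using (_⇔_; mk⇔; Equivalence)
import Function.Properties.Equivalence as ⇔
open import Algebra.Bundles using (CommutativeRing)
import Algebra.Properties.Ring as RingProperties
import Algebra.Properties.Semiring.Sum as SemiringSum
open import Data.Nat.Base as ℕ using (ℕ; zero; suc; _^_; _<_; _≤_; z≤n; s≤s; NonZero)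
import Data.Nat.Properties as ℕ
import Data.Nat.Divisibility as ℕ∣
open import Data.Nat.DivMod using (_%_; _/_; m≡m%n+[m/n]*n; m%n<n)
open import Data.Nat.Primality using (Prime; euclidsLemma; ¬prime[1])
open import Data.Integer.Base using (ℤ; +_; _+_; _-_; _*_; -_; 0ℤ; 1ℤ; ∣_∣; _⊖_; ≢-nonZero)
import Data.Integer.Properties as ℤ
import Data.Integer.Divisibility as ℤ∣
open import Data.Integer.Divisibility.Signed
  using (_∣_; divides; ∣ᵤ⇒∣; ∣⇒∣ᵤ; ∣m∣n⇒∣m+n; ∣m∣n⇒∣m-n; ∣m+n∣n⇒∣m; ∣m+n∣m⇒∣n;
         ∣m⇒∣-m; ∣m⇒∣m*n; ∣n⇒∣m*n)
open import Data.Integer.Tactic.RingSolver using (solve-∀)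
open SemiringSum ℤ.+-*-semiring using (sum; sum-cong-≗; ∑-comm; ∑-distrib-+; *-distribˡ-sum; *-distribʳ-sum)
open import Data.Fin.Base as Fin using (Fin; toℕ)
import Data.Fin.Properties as Fin
open import Data.Vec.Functional using (_∷_; tail)
open import Data.Bool.Base using (Bool; true; false; _∧_; _∨_)
open import Data.Bool.Properties using (∧-idem)
open import Data.Product using (∃; _×_; _,_; proj₁; proj₂)
open import Data.Sum.Base using (_⊎_; inj₁; inj₂)
open import Data.Empty using (⊥; ⊥-elim)
open import Relation.Binary.PropositionalEquality
  using (_≡_; _≢_; _≗_; refl; sym; trans; cong; cong₂; subst; module ≡-Reasoning)
open import Relation.Nullary using (¬_; Dec; yes; no; does; ¬?; _×-dec_)
open import Relation.Nullary.Decidable using (map′; dec-true; dec-false)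

𝟙 : ∀ {a} {P : Set a} → Dec P → ℤ
𝟙 P? = ⟦ does P? ⟧

𝟙-yes : ∀ {a} {P : Set a} (P? : Dec P) → P → 𝟙 P? ≡ 1ℤ
𝟙-yes (yes _) _ = refl
𝟙-yes (no ¬p) p = ⊥-elim (¬p p)

𝟙-no : ∀ {a} {P : Set a} (P? : Dec P) → ¬ P → 𝟙 P? ≡ 0ℤ
𝟙-no (yes p) ¬p = ⊥-elim (¬p p)
𝟙-no (no _)  _  = refl

𝟙-cong : ∀ {a b} {P : Set a} {R : Set b} (P? : Dec P) (R? : Dec R) → P ⇔ R → 𝟙 P? ≡ 𝟙 R?
𝟙-cong (yes p) R? P⇔R = sym (𝟙-yes R? (Equivalence.to P⇔R p))
𝟙-cong (no ¬p) R? P⇔R = sym (𝟙-no R? (λ r → ¬p (Equivalence.from P⇔R r)))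

𝟙-¬ : ∀ {a} {P : Set a} (P? : Dec P) → 𝟙 (¬? P?) ≡ 1ℤ - 𝟙 P?
𝟙-¬ (yes _) = refl
𝟙-¬ (no _)  = refl

𝟙-× : ∀ {a b} {P : Set a} {R : Set b} (P? : Dec P) (R? : Dec R) → 𝟙 (P? ×-dec R?) ≡ 𝟙 P? * 𝟙 R?
𝟙-× (yes _) (yes _) = refl
𝟙-× (yes _) (no _)  = refl
𝟙-× (no _)  _       = refl

𝟙-×-no : ∀ {a b} {P : Set a} {R : Set b} (P? : Dec P) (R? : Dec R) → (P → R → ⊥) → 𝟙 P? * 𝟙 R? ≡ 0ℤ
𝟙-×-no P? R? ¬PR = trans (sym (𝟙-× P? R?)) (𝟙-no (P? ×-dec R?) (λ (p , r) → ¬PR p r))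

𝟙-*-congʳ : ∀ {a b c} {P : Set a} {R : Set b} {R′ : Set c} (P? : Dec P) (R? : Dec R) (R′? : Dec R′) →
             (P → R ⇔ R′) → 𝟙 P? * 𝟙 R? ≡ 𝟙 P? * 𝟙 R′?
𝟙-*-congʳ (yes p) R? R′? R⇔R′ = cong (1ℤ *_) (𝟙-cong R? R′? (R⇔R′ p))
𝟙-*-congʳ (no _)  R? R′? R⇔R′ = refl

does-⇔ : ∀ {a} {P : Set a} (P? : Dec P) → does P? ≡ true ⇔ P
does-⇔ (yes p) = mk⇔ (λ _ → p) (λ _ → refl)
does-⇔ (no ¬p) = mk⇔ (λ ()) (λ p → ⊥-elim (¬p p))

⟦⟧≡𝟙 : ∀ {a} {P : Set a} (u : Bool) (P? : Dec P) → (u ≡ true ⇔ P) → ⟦ u ⟧ ≡ 𝟙 P?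
⟦⟧≡𝟙 true  P? u⇔P = sym (𝟙-yes P? (Equivalence.to u⇔P refl))
⟦⟧≡𝟙 false P? u⇔P = sym (𝟙-no P? (λ p → false≢true (Equivalence.from u⇔P p)))
  where
  false≢true : false ≢ true
  false≢true ()

∧≡true⇔ : ∀ {a b} → a ∧ b ≡ true ⇔ (a ≡ true × b ≡ true)
∧≡true⇔ {true}  {b} = mk⇔ (λ b≡true → refl , b≡true) proj₂
∧≡true⇔ {false} {b} = mk⇔ (λ ()) (λ ())

⟦⟧-∧ : ∀ a b → ⟦ a ⟧ * ⟦ b ⟧ ≡ ⟦ a ∧ b ⟧
⟦⟧-∧ true  true  = refl
⟦⟧-∧ true  false = refl
⟦⟧-∧ false b     = refl

sum-zero : ∀ {n} (f : Fin n → ℤ) → (∀ i → f i ≡ 0ℤ) → sum f ≡ 0ℤ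
sum-zero {zero}  f f≡0 = refl
sum-zero {suc n} f f≡0 = cong₂ _+_ (f≡0 Fin.zero) (sum-zero (λ i → f (Fin.suc i)) (λ i → f≡0 (Fin.suc i)))

sum-single : ∀ {n} (f : Fin n → ℤ) i₀ → (∀ i → i ≢ i₀ → f i ≡ 0ℤ) → sum f ≡ f i₀
sum-single f Fin.zero f≡0 =
  trans (cong (λ z → f Fin.zero + z) (sum-zero _ (λ i → f≡0 (Fin.suc i) (λ ())))) (ℤ.+-identityʳ _)
sum-single f (Fin.suc i₀) f≡0 =
  trans (cong₂ _+_ (f≡0 Fin.zero (λ ())) (sum-single (λ i → f (Fin.suc i)) i₀
          (λ i i≢i₀ → f≡0 (Fin.suc i) (λ e → i≢i₀ (Fin.suc-injective e)))))
        (ℤ.+-identityˡ _)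

sum-const : ∀ n x → sum {n} (λ _ → x) ≡ + n * x
sum-const zero    x = sym (ℤ.*-zeroˡ x)
sum-const (suc n) x = trans (cong (λ z → x + z) (sum-const n x))
  (sym (trans (cong (_* x) (ℤ.pos-+ 1 n)) (distrib x (+ n))))
  where
  distrib : ∀ x y → (1ℤ + y) * x ≡ x + y * x
  distrib = solve-∀

sum-neg : ∀ {n} (f : Fin n → ℤ) → sum (λ i → - f i) ≡ - sum f
sum-neg f = trans (sum-cong-≗ (λ i → sym (ℤ.-1*i≡-i (f i))))
                  (trans (sym (*-distribˡ-sum (- 1ℤ) f)) (ℤ.-1*i≡-i (sum f)))

sum-sub : ∀ {n} (f g : Fin n → ℤ) → sum (λ i → f i - g i) ≡ sum f - sum g
sum-sub f g = trans (∑-distrib-+ f (λ i → - g i)) (cong (λ z → sum f + z) (sum-neg g))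

Σℤ≡sum : ∀ n (f : Fin n → ℤ) → Σℤ n f ≡ sum f
Σℤ≡sum zero    f = refl
Σℤ≡sum (suc n) f = cong (λ z → f Fin.zero + z) (Σℤ≡sum n (λ i → f (Fin.suc i)))

Σℤ-cong : ∀ n {f g : Fin n → ℤ} → (∀ i → f i ≡ g i) → Σℤ n f ≡ Σℤ n g
Σℤ-cong zero    f≡g = refl
Σℤ-cong (suc n) f≡g = cong₂ _+_ (f≡g Fin.zero) (Σℤ-cong n (λ i → f≡g (Fin.suc i)))

Σℤ-zero : ∀ n (f : Fin n → ℤ) → (∀ i → f i ≡ 0ℤ) → Σℤ n f ≡ 0ℤ
Σℤ-zero n f f≡0 = trans (Σℤ≡sum n f) (sum-zero f f≡0)

Σℤ-single : ∀ n (f : Fin n → ℤ) i₀ → (∀ i → i ≢ i₀ → f i ≡ 0ℤ) → Σℤ n f ≡ f i₀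
Σℤ-single n f i₀ f≡0 = trans (Σℤ≡sum n f) (sum-single f i₀ f≡0)

Σℤ-sub-single : ∀ n (f g : Fin n → ℤ) i₀ → (∀ i → i ≢ i₀ → f i ≡ g i) → Σℤ n f - Σℤ n g ≡ f i₀ - g i₀
Σℤ-sub-single n f g i₀ f≡g = begin
  Σℤ n f - Σℤ n g          ≡⟨ cong₂ _-_ (Σℤ≡sum n f) (Σℤ≡sum n g) ⟩
  sum f - sum g            ≡⟨ sum-sub f g ⟨
  sum (λ i → f i - g i)    ≡⟨ sum-single _ i₀ (λ i i≢i₀ →
                                trans (cong (λ z → f i - z) (sym (f≡g i i≢i₀))) (ℤ.+-inverseʳ (f i))) ⟩
  f i₀ - g i₀              ∎
  where open ≡-Reasoning

Πℤ-cong : ∀ n {f g : Fin n → ℤ} → (∀ i → f i ≡ g i) → Πℤ n f ≡ Πℤ n g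
Πℤ-cong zero    f≡g = refl
Πℤ-cong (suc n) f≡g = cong₂ _*_ (f≡g Fin.zero) (Πℤ-cong n (λ i → f≡g (Fin.suc i)))

∣Σℤ : ∀ {d} n (f : Fin n → ℤ) → (∀ i → d ∣ f i) → d ∣ Σℤ n f
∣Σℤ zero    f d∣f = divides 0ℤ refl
∣Σℤ (suc n) f d∣f = ∣m∣n⇒∣m+n (d∣f Fin.zero) (∣Σℤ n (λ i → f (Fin.suc i)) (λ i → d∣f (Fin.suc i)))

∣Σℤ-except : ∀ {d} n (f : Fin n → ℤ) i₀ → (∀ i → i ≢ i₀ → d ∣ f i) → d ∣ Σℤ n f - f i₀
∣Σℤ-except (suc n) f Fin.zero d∣f = subst (_ ∣_) (sym (cancel (f Fin.zero) _))
  (∣Σℤ n (λ i → f (Fin.suc i)) (λ i → d∣f (Fin.suc i) (λ ())))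
  where
  cancel : ∀ x y → x + y - x ≡ y
  cancel = solve-∀
∣Σℤ-except (suc n) f (Fin.suc i₀) d∣f = subst (_ ∣_) (sym (assoc (f Fin.zero) _ _))
  (∣m∣n⇒∣m+n (d∣f Fin.zero (λ ()))
              (∣Σℤ-except n (λ i → f (Fin.suc i)) i₀ (λ i i≢i₀ → d∣f (Fin.suc i) (λ e → i≢i₀ (Fin.suc-injective e)))))
  where
  assoc : ∀ x y z → x + y - z ≡ x + (y - z)
  assoc = solve-∀

∣Πℤ : ∀ {d} n (f : Fin n → ℤ) t → d ∣ f t → d ∣ Πℤ n f
∣Πℤ (suc n) f Fin.zero    d∣f = ∣m⇒∣m*n _ d∣f
∣Πℤ (suc n) f (Fin.suc t) d∣f = ∣n⇒∣m*n (f Fin.zero) (∣Πℤ n (λ i → f (Fin.suc i)) t d∣f)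

[q-1]*qint≡q^-1 : ∀ q a → (+ q - 1ℤ) * + qint q a ≡ + (q ^ a) - 1ℤ
[q-1]*qint≡q^-1 q zero    = ℤ.*-zeroʳ (+ q - 1ℤ)
[q-1]*qint≡q^-1 q (suc a) = begin
  (+ q - 1ℤ) * + (q ^ a ℕ.+ qint q a)                ≡⟨ cong ((+ q - 1ℤ) *_) (ℤ.pos-+ (q ^ a) (qint q a)) ⟩
  (+ q - 1ℤ) * (+ (q ^ a) + + qint q a)              ≡⟨ step (+ q) (+ (q ^ a)) (+ qint q a) ⟩
  + q * + (q ^ a) - + (q ^ a) + (+ q - 1ℤ) * + qint q a
                                                     ≡⟨ cong (λ z → + q * + (q ^ a) - + (q ^ a) + z) ([q-1]*qint≡q^-1 q a) ⟩
  + q * + (q ^ a) - + (q ^ a) + (+ (q ^ a) - 1ℤ)     ≡⟨ cancel (+ q * + (q ^ a)) (+ (q ^ a)) ⟩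
  + q * + (q ^ a) - 1ℤ                               ≡⟨ cong (_- 1ℤ) (ℤ.pos-* q (q ^ a)) ⟨
  + (q ^ suc a) - 1ℤ                                 ∎
  where
  open ≡-Reasoning
  step : ∀ x y z → (x - 1ℤ) * (y + z) ≡ x * y - y + (x - 1ℤ) * z
  step = solve-∀
  cancel : ∀ x y → x - y + (y - 1ℤ) ≡ x - 1ℤ
  cancel = solve-∀

∣+[a+e]-+a∣ : ∀ a e → ∣ + (a ℕ.+ e) - + a ∣ ≡ e
∣+[a+e]-+a∣ a e = begin
  ∣ + (a ℕ.+ e) - + a ∣   ≡⟨ cong ∣_∣ (ℤ.[+m]-[+n]≡m⊖n (a ℕ.+ e) a) ⟩
  ∣ (a ℕ.+ e) ⊖ a ∣       ≡⟨ cong ∣_∣ (ℤ.⊖-≥ (ℕ.m≤m+n a e)) ⟩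
  a ℕ.+ e ℕ.∸ a           ≡⟨ ℕ.m+n∸m≡n a e ⟩
  e                       ∎
  where open ≡-Reasoning

Cong-+ʳ⇔ : ∀ {a e m} → Cong (a ℕ.+ e) a m ⇔ m ℕ∣.∣ e
Cong-+ʳ⇔ {a} {e} {m} = mk⇔ (subst (m ℕ∣.∣_) (∣+[a+e]-+a∣ a e)) (subst (m ℕ∣.∣_) (sym (∣+[a+e]-+a∣ a e)))

Cong-sym : ∀ {a a′ m} → Cong a a′ m → Cong a′ a m
Cong-sym {a} {a′} {m} = subst (m ℕ∣.∣_) (trans (sym (ℤ.∣-i∣≡∣i∣ (+ a - + a′))) (cong ∣_∣ (neg-sub (+ a) (+ a′))))
  where
  neg-sub : ∀ x y → - (x - y) ≡ y - x
  neg-sub = solve-∀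

∣-<⇒≡0 : ∀ {m e} → m ℕ∣.∣ e → e < m → e ≡ 0
∣-<⇒≡0 {e = zero}  _   _   = refl
∣-<⇒≡0 {e = suc _} m∣e e<m = ⊥-elim (ℕ∣.>⇒∤ e<m m∣e)

Cong-≤-<⇒≡ : ∀ {a a′ m} → a′ ≤ a → a < m → Cong a a′ m → a′ ≡ a
Cong-≤-<⇒≡ {a} {a′} {m} a′≤a a<m = via-difference (a ℕ.∸ a′) (ℕ.m+[n∸m]≡n a′≤a) (ℕ.≤-<-trans (ℕ.m∸n≤m a a′) a<m)
  where
  via-difference : ∀ {a} e → a′ ℕ.+ e ≡ a → e < m → Cong a a′ m → a′ ≡ a
  via-difference e refl e<m h = trans (sym (ℕ.+-identityʳ a′)) (cong (a′ ℕ.+_) (sym (∣-<⇒≡0 (Equivalence.to (Cong-+ʳ⇔ {a′} {e}) h) e<m)))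

Cong-<⇒≡ : ∀ {a a′ m} → a < m → a′ < m → Cong a a′ m → a ≡ a′
Cong-<⇒≡ {a} {a′} a<m a′<m h with ℕ.≤-total a′ a
... | inj₁ a′≤a = sym (Cong-≤-<⇒≡ a′≤a a<m h)
... | inj₂ a≤a′ = Cong-≤-<⇒≡ a≤a′ a′<m (Cong-sym {a} {a′} h)

¬Cong⇒2≤ : ∀ {a a′ m} → 0 < m → ¬ Cong a a′ m → 2 ≤ m
¬Cong⇒2≤ {m = suc zero}    _ ¬a≡a′ = ⊥-elim (¬a≡a′ (ℕ∣.1∣ _))
¬Cong⇒2≤ {m = suc (suc m)} _ _     = s≤s (s≤s z≤n)

Cong? : ∀ a a′ m → Dec (Cong a a′ m)
Cong? a a′ m = m ℕ∣.∣? ∣ + a - + a′ ∣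

module Residues (q p b : ℕ) (p-prime : Prime p) (0<b : 0 < b)
                (q^b≡1 : Cong (q ^ b) 1 p)
                (q^i≢1 : ∀ i → 0 < i → i < b → ¬ Cong (q ^ i) 1 p) where

  infix 4 p∣_
  p∣_ : ℤ → Set
  p∣ x = + p ∣ x

  p∤1 : ¬ p∣ 1ℤ
  p∤1 p∣1 = ¬prime[1] (subst Prime (ℕ∣.∣1⇒≡1 (∣⇒∣ᵤ p∣1)) p-prime)

  p∣-euclid : ∀ x y → p∣ x * y → p∣ x ⊎ p∣ y
  p∣-euclid x y p∣xy with euclidsLemma ∣ x ∣ ∣ y ∣ p-prime (subst (p ℕ∣.∣_) (ℤ.abs-* x y) (∣⇒∣ᵤ p∣xy))
  ... | inj₁ p∣x = inj₁ (∣ᵤ⇒∣ p∣x)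
  ... | inj₂ p∣y = inj₂ (∣ᵤ⇒∣ p∣y)

  p∣-cancelˡ : ∀ {x y} → ¬ p∣ x → p∣ x * y ⇔ p∣ y
  p∣-cancelˡ {x} {y} p∤x = mk⇔ to (∣n⇒∣m*n x)
    where
    to : p∣ x * y → p∣ y
    to p∣xy with p∣-euclid x y p∣xy
    ... | inj₁ p∣x = ⊥-elim (p∤x p∣x)
    ... | inj₂ p∣y = p∣y

  p∣-sub-comm : ∀ x y → p∣ x - y ⇔ p∣ y - x
  p∣-sub-comm x y = mk⇔ (λ h → subst p∣_ (neg-sub x y) (∣m⇒∣-m h)) (λ h → subst p∣_ (neg-sub y x) (∣m⇒∣-m h))
    where
    neg-sub : ∀ x y → - (x - y) ≡ y - x
    neg-sub = solve-∀

  p∣-cancelʳ : ∀ {x y} → ¬ p∣ y → p∣ x * y ⇔ p∣ x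
  p∣-cancelʳ {x} {y} p∤y = ⇔.trans (mk⇔ (subst p∣_ (ℤ.*-comm x y)) (subst p∣_ (ℤ.*-comm y x))) (p∣-cancelˡ p∤y)

  Q : ℕ → ℤ
  Q a = + (q ^ a)

  [_] : ℕ → ℤ
  [ a ] = + qint q a

  Q-+ : ∀ a e → Q (a ℕ.+ e) ≡ Q a * Q e
  Q-+ a e = trans (cong +_ (ℕ.^-distribˡ-+-* q a e)) (ℤ.pos-* (q ^ a) (q ^ e))

  [a+e]-[a] : ∀ a e → (+ q - 1ℤ) * ([ a ℕ.+ e ] - [ a ]) ≡ Q a * (Q e - 1ℤ)
  [a+e]-[a] a e = begin
    (+ q - 1ℤ) * ([ a ℕ.+ e ] - [ a ])                    ≡⟨ distrib (+ q - 1ℤ) [ a ℕ.+ e ] [ a ] ⟩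
    (+ q - 1ℤ) * [ a ℕ.+ e ] - (+ q - 1ℤ) * [ a ]         ≡⟨ cong₂ _-_ ([q-1]*qint≡q^-1 q (a ℕ.+ e)) ([q-1]*qint≡q^-1 q a) ⟩
    (Q (a ℕ.+ e) - 1ℤ) - (Q a - 1ℤ)                      ≡⟨ cong (λ z → (z - 1ℤ) - (Q a - 1ℤ)) (Q-+ a e) ⟩
    (Q a * Q e - 1ℤ) - (Q a - 1ℤ)                        ≡⟨ factor (Q a) (Q e) ⟩
    Q a * (Q e - 1ℤ)                                     ∎
    where
    open ≡-Reasoning
    distrib : ∀ x y z → x * (y - z) ≡ x * y - x * z
    distrib = solve-∀
    factor : ∀ x y → (x * y - 1ℤ) - (x - 1ℤ) ≡ x * (y - 1ℤ)
    factor = solve-∀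

  p∣Q[b]-1 : p∣ Q b - 1ℤ
  p∣Q[b]-1 = ∣ᵤ⇒∣ q^b≡1

  p∤q : ¬ p∣ + q
  p∤q p∣q = p∤Q[c]-1 b 0<b p∣Q[b]-1
    where
    cancel : ∀ x → x - (x - 1ℤ) ≡ 1ℤ
    cancel = solve-∀
    p∤Q[c]-1 : ∀ c → 0 < c → ¬ p∣ Q c - 1ℤ
    p∤Q[c]-1 (suc c) _ p∣Q[c]-1 = p∤1 (subst p∣_ (cancel (Q (suc c)))
      (∣m∣n⇒∣m-n (subst p∣_ (sym (ℤ.pos-* q (q ^ c))) (∣m⇒∣m*n (Q c) p∣q)) p∣Q[c]-1))

  p∤Q : ∀ a → ¬ p∣ Q a
  p∤Q zero    = p∤1
  p∤Q (suc a) p∣Q with p∣-euclid (+ q) (Q a) (subst p∣_ (ℤ.pos-* q (q ^ a)) p∣Q)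
  ... | inj₁ p∣q = p∤q p∣q
  ... | inj₂ p∣Qa = p∤Q a p∣Qa

  p∣Q[tb]-1 : ∀ t → p∣ Q (t ℕ.* b) - 1ℤ
  p∣Q[tb]-1 zero    = divides 0ℤ refl
  p∣Q[tb]-1 (suc t) = subst p∣_ (sym split) (∣m∣n⇒∣m+n (∣n⇒∣m*n (Q b) (p∣Q[tb]-1 t)) p∣Q[b]-1)
    where
    regroup : ∀ x y → x * y - 1ℤ ≡ x * (y - 1ℤ) + (x - 1ℤ)
    regroup = solve-∀
    split : Q (suc t ℕ.* b) - 1ℤ ≡ Q b * (Q (t ℕ.* b) - 1ℤ) + (Q b - 1ℤ)
    split = trans (cong (_- 1ℤ) (Q-+ b (t ℕ.* b))) (regroup (Q b) (Q (t ℕ.* b)))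

  p∣Q-1⇔b∣ : ∀ e → p∣ Q e - 1ℤ ⇔ b ℕ∣.∣ e
  p∣Q-1⇔b∣ e = mk⇔ to from
    where
    instance
      b≢0 : NonZero b
      b≢0 = ℕ.>-nonZero 0<b
    from : b ℕ∣.∣ e → p∣ Q e - 1ℤ
    from (ℕ∣.divides t refl) = p∣Q[tb]-1 t
    r = e % b
    regroup : ∀ x y → x * y - 1ℤ - x * (y - 1ℤ) ≡ x - 1ℤ
    regroup = solve-∀
    e-split : Q e - 1ℤ ≡ Q r * Q (e / b ℕ.* b) - 1ℤ
    e-split = cong (_- 1ℤ) (trans (cong Q (m≡m%n+[m/n]*n e b)) (Q-+ r (e / b ℕ.* b)))
    p∣Q[r]-1 : p∣ Q e - 1ℤ → p∣ Q r - 1ℤ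
    p∣Q[r]-1 h = subst p∣_ (regroup (Q r) (Q (e / b ℕ.* b)))
      (∣m∣n⇒∣m-n (subst p∣_ e-split h) (∣n⇒∣m*n (Q r) (p∣Q[tb]-1 (e / b))))
    to : p∣ Q e - 1ℤ → b ℕ∣.∣ e
    to h with r in r≡ | p∣Q[r]-1 h
    ... | zero  | _ = ℕ∣.m%n≡0⇒n∣m e b r≡
    ... | suc i | p∣Q[i]-1 = ⊥-elim (q^i≢1 (suc i) (s≤s z≤n) (subst (_< b) r≡ (m%n<n e b)) (∣⇒∣ᵤ p∣Q[i]-1))

  p∤q-1 : 2 ≤ b → ¬ p∣ + q - 1ℤ
  p∤q-1 2≤b p∣q-1 = q^i≢1 1 (s≤s z≤n) 2≤b
    (∣⇒∣ᵤ (subst (λ z → p∣ + z - 1ℤ) (sym (ℕ.*-identityʳ q)) p∣q-1))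

  -- (q - 1) ([a + e] - [a]) = q^a (q^e - 1), and q - 1 and q^a are units mod p.
  p∣[a+e]-[a]⇔Cong : 2 ≤ b → ∀ a e → p∣ [ a ℕ.+ e ] - [ a ] ⇔ Cong (a ℕ.+ e) a b
  p∣[a+e]-[a]⇔Cong 2≤b a e =
    ⇔.trans (⇔.sym (p∣-cancelˡ (p∤q-1 2≤b)))
    (⇔.trans (mk⇔ (subst p∣_ ([a+e]-[a] a e)) (subst p∣_ (sym ([a+e]-[a] a e))))
    (⇔.trans (p∣-cancelˡ (p∤Q a))
    (⇔.trans (p∣Q-1⇔b∣ e) (⇔.sym (Cong-+ʳ⇔ {a} {e})))))

  p∣[a]-[a′]⇔Cong-≤ : 2 ≤ b → ∀ {a a′} → a′ ≤ a → p∣ [ a ] - [ a′ ] ⇔ Cong a a′ b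
  p∣[a]-[a′]⇔Cong-≤ 2≤b {a} {a′} a′≤a = subst (λ z → p∣ [ z ] - [ a′ ] ⇔ Cong z a′ b) (ℕ.m+[n∸m]≡n a′≤a)
    (p∣[a+e]-[a]⇔Cong 2≤b a′ (a ℕ.∸ a′))

  p∣[a]-[a′]⇔Cong : 2 ≤ b → ∀ a a′ → p∣ [ a ] - [ a′ ] ⇔ Cong a a′ b
  p∣[a]-[a′]⇔Cong 2≤b a a′ with ℕ.≤-total a′ a
  ... | inj₁ a′≤a = p∣[a]-[a′]⇔Cong-≤ 2≤b a′≤a
  ... | inj₂ a≤a′ = ⇔.trans (p∣-sub-comm [ a ] [ a′ ])
                      (⇔.trans (p∣[a]-[a′]⇔Cong-≤ 2≤b a≤a′) (mk⇔ (Cong-sym {a′} {a}) (Cong-sym {a} {a′})))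

  p∤Πℤ : ∀ n (f : Fin n → ℤ) → (∀ t → ¬ p∣ f t) → ¬ p∣ Πℤ n f
  p∤Πℤ zero    f p∤f = p∤1
  p∤Πℤ (suc n) f p∤f p∣Π with p∣-euclid (f Fin.zero) (Πℤ n (λ t → f (Fin.suc t))) p∣Π
  ... | inj₁ p∣f₀ = p∤f Fin.zero p∣f₀
  ... | inj₂ p∣Π′ = p∤Πℤ n (λ t → f (Fin.suc t)) (λ t → p∤f (Fin.suc t)) p∣Π′

module FieldFacts {q : ℕ} (F : FiniteField q) where

  open FiniteField F public renaming (_+_ to infixl 6 _+F_; _*_ to infixl 7 _*F_; -_ to infix 8 -F_)

  commutativeRing : CommutativeRing 0ℓ 0ℓ
  commutativeRing = record { isCommutativeRing = isCommutativeRing }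

  open CommutativeRing commutativeRing public
    using (+-identityʳ; -‿inverseʳ; *-assoc; *-comm; *-identityˡ; zeroˡ; zeroʳ; distribʳ)
  open RingProperties (CommutativeRing.ring commutativeRing) public
    using (x∙y⁻¹≈ε⇒x≈y; -‿distribˡ-*; -1*x≈-x)

  infix 4 _≟_
  _≟_ : (x y : Carrier) → Dec (x ≡ y)
  x ≟ y with enum-surjective x | enum-surjective y
  ... | i , refl | j , refl with i Fin.≟ j
  ... | yes refl = yes refl
  ... | no i≢j   = no (λ e → i≢j (enum-injective i j e))

  *-cancelˡ : ∀ {x y z} → x ≢ 0# → x *F y ≡ x *F z → y ≡ z
  *-cancelˡ {x} {y} {z} x≢0 xy≡xz with inverse x x≢0
  ... | x⁻¹ , xx⁻¹≡1 = begin
    y                   ≡⟨ sym (*-identityˡ y) ⟩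
    1# *F y             ≡⟨ cong (_*F y) (trans (sym xx⁻¹≡1) (*-comm x x⁻¹)) ⟩
    (x⁻¹ *F x) *F y     ≡⟨ *-assoc x⁻¹ x y ⟩
    x⁻¹ *F (x *F y)     ≡⟨ cong (x⁻¹ *F_) xy≡xz ⟩
    x⁻¹ *F (x *F z)     ≡⟨ sym (*-assoc x⁻¹ x z) ⟩
    (x⁻¹ *F x) *F z     ≡⟨ cong (_*F z) (trans (*-comm x⁻¹ x) xx⁻¹≡1) ⟩
    1# *F z             ≡⟨ *-identityˡ z ⟩
    z                   ∎
    where open ≡-Reasoning

  ∑C : (Carrier → ℤ) → ℤ
  ∑C f = sum (λ i → f (enum i))

  ∑C-cong : ∀ {f g : Carrier → ℤ} → (∀ c → f c ≡ g c) → ∑C f ≡ ∑C g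
  ∑C-cong f≡g = sum-cong-≗ (λ i → f≡g (enum i))

  ∑C-single : ∀ (f : Carrier → ℤ) c₀ → (∀ c → c ≢ c₀ → f c ≡ 0ℤ) → ∑C f ≡ f c₀
  ∑C-single f c₀ f≡0 = at (enum-surjective c₀)
    where
    at : (∃ λ i₀ → enum i₀ ≡ c₀) → ∑C f ≡ f c₀
    at (i₀ , i₀↦c₀) = trans
      (sum-single _ i₀ (λ i i≢i₀ → f≡0 (enum i) (λ e → i≢i₀ (enum-injective i i₀ (trans e (sym i₀↦c₀))))))
      (cong f i₀↦c₀)

  ∑C-δ : ∀ c₀ → ∑C (λ c → 𝟙 (c ≟ c₀)) ≡ 1ℤ
  ∑C-δ c₀ = trans (∑C-single _ c₀ (λ c c≢c₀ → 𝟙-no (c ≟ c₀) c≢c₀)) (𝟙-yes (c₀ ≟ c₀) refl)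

  q≢1 : q ≢ 1
  q≢1 refl = 0≢1 (trans (sym (proj₂ (enum-surjective 0#))) (trans (cong enum (one _ _)) (proj₂ (enum-surjective 1#))))
    where
    one : (i j : Fin 1) → i ≡ j
    one Fin.zero Fin.zero = refl

  ∑C-≢0 : ∑C (λ c → 𝟙 (¬? (c ≟ 0#))) ≡ + q - 1ℤ
  ∑C-≢0 = begin
    ∑C (λ c → 𝟙 (¬? (c ≟ 0#)))                  ≡⟨ ∑C-cong (λ c → 𝟙-¬ (c ≟ 0#)) ⟩
    ∑C (λ c → 1ℤ - 𝟙 (c ≟ 0#))                  ≡⟨ sum-sub (λ _ → 1ℤ) (λ i → 𝟙 (enum i ≟ 0#)) ⟩
    sum {q} (λ _ → 1ℤ) - ∑C (λ c → 𝟙 (c ≟ 0#))  ≡⟨ cong₂ _-_ (trans (sum-const q 1ℤ) (ℤ.*-identityʳ (+ q))) (∑C-δ 0#) ⟩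
    + q - 1ℤ                                    ∎
    where open ≡-Reasoning

  Coords : ℕ → Set
  Coords d = Fin d → Carrier

  infix 4 _≗?_
  _≗?_ : ∀ {d} (a b : Coords d) → Dec (a ≗ b)
  a ≗? b = Fin.all? (λ i → a i ≟ b i)

  ∑V : ∀ d → (Coords d → ℤ) → ℤ
  ∑V zero    f = f (λ ())
  ∑V (suc d) f = ∑C (λ c → ∑V d (λ a → f (c ∷ a)))

  ∑V-cong : ∀ d {f g : Coords d → ℤ} → (∀ a → f a ≡ g a) → ∑V d f ≡ ∑V d g
  ∑V-cong zero    f≡g = f≡g _
  ∑V-cong (suc d) f≡g = ∑C-cong (λ c → ∑V-cong d (λ a → f≡g (c ∷ a)))

  ∑V-*ˡ : ∀ d x (f : Coords d → ℤ) → ∑V d (λ a → x * f a) ≡ x * ∑V d f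
  ∑V-*ˡ zero    x f = refl
  ∑V-*ˡ (suc d) x f = trans (∑C-cong (λ c → ∑V-*ˡ d x (λ a → f (c ∷ a))))
                            (sym (*-distribˡ-sum x (λ i → ∑V d (λ a → f (enum i ∷ a)))))

  ∑V-+ : ∀ d (f g : Coords d → ℤ) → ∑V d (λ a → f a + g a) ≡ ∑V d f + ∑V d g
  ∑V-+ zero    f g = refl
  ∑V-+ (suc d) f g = trans (∑C-cong (λ c → ∑V-+ d (λ a → f (c ∷ a)) (λ a → g (c ∷ a))))
                           (∑-distrib-+ (λ i → ∑V d (λ a → f (enum i ∷ a))) (λ i → ∑V d (λ a → g (enum i ∷ a))))

  ∑V-comm : ∀ d {k} (f : Coords d → Fin k → ℤ) →
            ∑V d (λ a → sum (f a)) ≡ sum (λ i → ∑V d (λ a → f a i))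
  ∑V-comm zero    f = refl
  ∑V-comm (suc d) f = trans (∑C-cong (λ c → ∑V-comm d (λ a → f (c ∷ a))))
                            (∑-comm (λ j i → ∑V d (λ a → f (enum j ∷ a) i)))

  ∑V-1 : ∀ d → ∑V d (λ _ → 1ℤ) ≡ + (q ^ d)
  ∑V-1 zero    = refl
  ∑V-1 (suc d) = trans (∑C-cong (λ _ → ∑V-1 d)) (trans (sum-const q (+ (q ^ d))) (sym (ℤ.pos-* q (q ^ d))))

  ∑V-δ : ∀ d (a₀ : Coords d) → ∑V d (λ a → 𝟙 (a ≗? a₀)) ≡ 1ℤ
  ∑V-δ zero    a₀ = 𝟙-yes ((λ ()) ≗? a₀) (λ ())
  ∑V-δ (suc d) a₀ = begin
    ∑C (λ c → ∑V d (λ a → 𝟙 (c ∷ a ≗? a₀)))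
      ≡⟨ ∑C-cong (λ c → ∑V-cong d (split c)) ⟩
    ∑C (λ c → ∑V d (λ a → 𝟙 (c ≟ a₀ Fin.zero) * 𝟙 (a ≗? tail a₀)))
      ≡⟨ ∑C-cong (λ c → ∑V-*ˡ d (𝟙 (c ≟ a₀ Fin.zero)) (λ a → 𝟙 (a ≗? tail a₀))) ⟩
    ∑C (λ c → 𝟙 (c ≟ a₀ Fin.zero) * ∑V d (λ a → 𝟙 (a ≗? tail a₀)))
      ≡⟨ ∑C-cong (λ c → trans (cong (𝟙 (c ≟ a₀ Fin.zero) *_) (∑V-δ d (tail a₀))) (ℤ.*-identityʳ (𝟙 (c ≟ a₀ Fin.zero)))) ⟩
    ∑C (λ c → 𝟙 (c ≟ a₀ Fin.zero))
      ≡⟨ ∑C-δ (a₀ Fin.zero) ⟩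
    1ℤ
      ∎
    where
    open ≡-Reasoning
    split : ∀ c a → 𝟙 (c ∷ a ≗? a₀) ≡ 𝟙 (c ≟ a₀ Fin.zero) * 𝟙 (a ≗? tail a₀)
    split c a = trans (𝟙-cong (c ∷ a ≗? a₀) ((c ≟ a₀ Fin.zero) ×-dec (a ≗? tail a₀))
                         (mk⇔ (λ e → e Fin.zero , λ i → e (Fin.suc i))
                              (λ { (e₀ , e) Fin.zero → e₀ ; (e₀ , e) (Fin.suc i) → e i })))
                      (𝟙-× (c ≟ a₀ Fin.zero) (a ≗? tail a₀))

  ∑V-zero : ∀ d (f : Coords d → ℤ) → (∀ a → f a ≡ 0ℤ) → ∑V d f ≡ 0ℤ
  ∑V-zero d f f≡0 = trans (∑V-cong d (λ a → trans (f≡0 a) (sym (ℤ.*-zeroˡ 1ℤ))))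
                          (trans (∑V-*ˡ d 0ℤ (λ _ → 1ℤ)) (ℤ.*-zeroˡ (∑V d (λ _ → 1ℤ))))

  ∑V-sub : ∀ d (f g : Coords d → ℤ) → ∑V d (λ a → f a - g a) ≡ ∑V d f - ∑V d g
  ∑V-sub d f g = trans (∑V-+ d f (λ a → - g a)) (cong (λ z → ∑V d f + z) neg)
    where
    neg : ∑V d (λ a → - g a) ≡ - ∑V d g
    neg = trans (∑V-cong d (λ a → sym (ℤ.-1*i≡-i (g a)))) (trans (∑V-*ˡ d (- 1ℤ) g) (ℤ.-1*i≡-i _))

  ∃C? : {P : Carrier → Set} → (∀ c → Dec (P c)) → Dec (∃ P)
  ∃C? {P} P? with Fin.any? (λ i → P? (enum i))
  ... | yes (i , p) = yes (enum i , p)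
  ... | no ¬p = no (λ (c , pc) → let (i , i↦c) = enum-surjective c in ¬p (i , subst P (sym i↦c) pc))

  ∃V? : ∀ d {P : Coords d → Set} → (∀ {a a′} → a ≗ a′ → P a → P a′) → (∀ a → Dec (P a)) → Dec (∃ P)
  ∃V? zero resp P? with P? (λ ())
  ... | yes p = yes (_ , p)
  ... | no ¬p = no (λ (a , pa) → ¬p (resp (λ ()) pa))
  ∃V? (suc d) {P} resp P?
    with ∃C? (λ c → ∃V? d (λ a≗a′ → resp (λ { Fin.zero → refl ; (Fin.suc i) → a≗a′ i })) (λ a → P? (c ∷ a)))
  ... | yes (c , a , p) = yes (c ∷ a , p)
  ... | no ¬p = no (λ (a , pa) → ¬p (a Fin.zero , tail a , resp (λ { Fin.zero → refl ; (Fin.suc i) → refl }) pa))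

module Span {q : ℕ} (F : FiniteField q) (n : ℕ) where

  open FieldFacts F
  open Lin F n
  module ∑F = SemiringSum (CommutativeRing.semiring commutativeRing)

  ΣF≡sum : ∀ d (f : Fin d → Carrier) → ΣF d f ≡ ∑F.sum f
  ΣF≡sum zero    f = refl
  ΣF≡sum (suc d) f = cong (f Fin.zero +F_) (ΣF≡sum d (λ i → f (Fin.suc i)))

  infixr 7 _·_
  _·_ : Carrier → Vec → Vec
  (c · w) i = c *F w i

  lincomb : ∀ {d} → (Fin d → Vec) → Coords d → Vec
  lincomb {d} β a i = ΣF d (λ j → a j *F β j i)

  lincomb-cong : ∀ {d} (β : Fin d → Vec) {a a′ : Coords d} → a ≗ a′ → lincomb β a ≗ lincomb β a′
  lincomb-cong {d} β a≗a′ i = trans (ΣF≡sum d _) (trans (∑F.sum-cong-≗ (λ j → cong (_*F β j i) (a≗a′ j))) (sym (ΣF≡sum d _)))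

  lincomb-* : ∀ {d} (β : Fin d → Vec) c (a : Coords d) → lincomb β (λ j → c *F a j) ≗ c · lincomb β a
  lincomb-* {d} β c a i = begin
    ΣF d (λ j → (c *F a j) *F β j i)   ≡⟨ ΣF≡sum d _ ⟩
    ∑F.sum (λ j → (c *F a j) *F β j i) ≡⟨ ∑F.sum-cong-≗ (λ j → *-assoc c (a j) (β j i)) ⟩
    ∑F.sum (λ j → c *F (a j *F β j i)) ≡⟨ ∑F.*-distribˡ-sum c (λ j → a j *F β j i) ⟨
    c *F ∑F.sum (λ j → a j *F β j i)   ≡⟨ cong (c *F_) (ΣF≡sum d _) ⟨
    c *F ΣF d (λ j → a j *F β j i)     ∎
    where open ≡-Reasoning

  lincomb-0 : ∀ {d} (β : Fin d → Vec) → lincomb β (λ _ → 0#) ≗ (λ _ → 0#)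
  lincomb-0 β i = trans (lincomb-cong β (λ j → sym (zeroˡ 0#)) i) (trans (lincomb-* β 0# (λ _ → 0#) i) (zeroˡ _))

  ∑F-neg : ∀ {d} (f : Fin d → Carrier) → ∑F.sum (λ j → -F f j) ≡ -F ∑F.sum f
  ∑F-neg f = trans (∑F.sum-cong-≗ (λ j → sym (-1*x≈-x (f j))))
                   (trans (sym (∑F.*-distribˡ-sum (-F 1#) f)) (-1*x≈-x (∑F.sum f)))

  lincomb-- : ∀ {d} (β : Fin d → Vec) (a a′ : Coords d) →
              lincomb β (λ j → a j +F -F a′ j) ≗ (λ i → lincomb β a i +F -F lincomb β a′ i)
  lincomb-- {d} β a a′ i = begin
    ΣF d (λ j → (a j +F -F a′ j) *F β j i)                    ≡⟨ ΣF≡sum d _ ⟩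
    ∑F.sum (λ j → (a j +F -F a′ j) *F β j i)                  ≡⟨ ∑F.sum-cong-≗ (λ j → distribʳ (β j i) (a j) (-F a′ j)) ⟩
    ∑F.sum (λ j → a j *F β j i +F -F a′ j *F β j i)           ≡⟨ ∑F.∑-distrib-+ (λ j → a j *F β j i) (λ j → -F a′ j *F β j i) ⟩
    ∑F.sum (λ j → a j *F β j i) +F ∑F.sum (λ j → -F a′ j *F β j i)
      ≡⟨ cong (∑F.sum (λ j → a j *F β j i) +F_) (∑F.sum-cong-≗ (λ j → sym (-‿distribˡ-* (a′ j) (β j i)))) ⟩
    ∑F.sum (λ j → a j *F β j i) +F ∑F.sum (λ j → -F (a′ j *F β j i))
      ≡⟨ cong (∑F.sum (λ j → a j *F β j i) +F_) (∑F-neg (λ j → a′ j *F β j i)) ⟩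
    ∑F.sum (λ j → a j *F β j i) +F -F ∑F.sum (λ j → a′ j *F β j i)
      ≡⟨ cong₂ (λ x y → x +F -F y) (ΣF≡sum d _) (ΣF≡sum d _) ⟨
    lincomb β a i +F -F lincomb β a′ i                        ∎
    where open ≡-Reasoning

  lincomb-injective : ∀ {d} {β : Fin d → Vec} → Independent β →
                      ∀ {a a′} → lincomb β a ≗ lincomb β a′ → a ≗ a′
  lincomb-injective {β = β} β-indep {a} {a′} eq j = x∙y⁻¹≈ε⇒x≈y (a j) (a′ j)
    (β-indep (λ j → a j +F -F a′ j)
             (λ i → trans (lincomb-- β a a′ i) (trans (cong (_+F -F lincomb β a′ i) (eq i)) (-‿inverseʳ _))) j)

  inSpan? : ∀ {d} (β : Fin d → Vec) w → Dec (InSpan β w)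
  inSpan? {d} β w = ∃V? d (λ a≗a′ w≗βa i → trans (w≗βa i) (lincomb-cong β a≗a′ i)) (λ a → w ≗? lincomb β a)

  0ᵛ : Vec
  0ᵛ _ = 0#

  nonzero-coordinate : ∀ {u : Vec} → ¬ u ≗ 0ᵛ → ∃ λ i → u i ≢ 0#
  nonzero-coordinate {u} = Fin.¬∀⟶∃¬ n (λ i → u i ≡ 0#) (λ i → u i ≟ 0#)

  ·-cancelʳ : ∀ {u c c′} → ¬ u ≗ 0ᵛ → c · u ≗ c′ · u → c ≡ c′
  ·-cancelʳ {u} {c} {c′} u≢0 cu≗c′u with nonzero-coordinate u≢0
  ... | i , uᵢ≢0 = *-cancelˡ uᵢ≢0 (trans (*-comm (u i) c) (trans (cu≗c′u i) (*-comm c′ (u i))))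

  ·-≢0 : ∀ {c u} → c ≢ 0# → ¬ u ≗ 0ᵛ → ¬ c · u ≗ 0ᵛ
  ·-≢0 {c} c≢0 u≢0 cu≗0 = u≢0 (λ i → *-cancelˡ c≢0 (trans (cu≗0 i) (sym (zeroʳ c))))

  ⟨_⟩ : Vec → Pred
  ⟨ w ⟩ v = ∃ λ c → v ≗ c · w

  ⟨⟩-trans : ∀ {u w} → ⟨ w ⟩ u → ⟨ u ⟩ ⊆ ⟨ w ⟩
  ⟨⟩-trans {u} {w} (κ , u≗κw) v (c , v≗cu) =
    c *F κ , λ i → trans (v≗cu i) (trans (cong (c *F_) (u≗κw i)) (sym (*-assoc c κ (w i))))

  ⟨⟩-sym : ∀ {u w κ} → κ ≢ 0# → u ≗ κ · w → ⟨ u ⟩ w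
  ⟨⟩-sym {u} {w} {κ} κ≢0 u≗κw with inverse κ κ≢0
  ... | κ⁻¹ , κκ⁻¹≡1 = κ⁻¹ , λ i → begin
    w i                   ≡⟨ *-identityˡ (w i) ⟨
    1# *F w i             ≡⟨ cong (_*F w i) (trans (sym κκ⁻¹≡1) (*-comm κ κ⁻¹)) ⟩
    κ⁻¹ *F κ *F w i       ≡⟨ *-assoc κ⁻¹ κ (w i) ⟩
    κ⁻¹ *F (κ *F w i)     ≡⟨ cong (κ⁻¹ *F_) (u≗κw i) ⟨
    κ⁻¹ *F u i            ∎
    where open ≡-Reasoning

  ⟨⟩-refl : ∀ w → ⟨ w ⟩ w
  ⟨⟩-refl w = 1# , λ i → sym (*-identityˡ (w i))

  InSpan₁⇔⟨⟩ : ∀ (γ : Fin 1 → Vec) v → InSpan γ v ⇔ ⟨ γ Fin.zero ⟩ v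
  InSpan₁⇔⟨⟩ γ v = mk⇔ (λ (a , v≗γa) → a Fin.zero , λ i → trans (v≗γa i) (+-identityʳ _))
                        (λ (c , v≗cγ) → (λ _ → c) , λ i → trans (v≗cγ i) (sym (+-identityʳ _)))

  span-single-dim₁ : ∀ {w} → ¬ w ≗ 0ᵛ → HasDim (InSpan (λ (_ : Fin 1) → w)) 1
  span-single-dim₁ {w} w≢0 = (λ _ → w) , independent , λ v → (λ x → x) , (λ x → x)
    where
    independent : Independent (λ (_ : Fin 1) → w)
    independent a aw≗0 Fin.zero with nonzero-coordinate w≢0
    ... | i , wᵢ≢0 = *-cancelˡ wᵢ≢0
      (trans (*-comm (w i) (a Fin.zero)) (trans (sym (+-identityʳ _)) (trans (aw≗0 i) (sym (zeroʳ (w i))))))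

  InSpan-⟨⟩ : ∀ {d} (β : Fin d → Vec) {u v} → InSpan β u → ⟨ u ⟩ v → InSpan β v
  InSpan-⟨⟩ β (a , u≗βa) (κ , v≗κu) =
    (λ j → κ *F a j) , λ i → trans (v≗κu i) (trans (cong (κ *F_) (u≗βa i)) (sym (lincomb-* β κ a i)))

  coefficient≢0 : ∀ {w u κ} → ¬ w ≗ 0ᵛ → w ≗ κ · u → κ ≢ 0#
  coefficient≢0 {u = u} w≢0 w≗κu refl = w≢0 (λ i → trans (w≗κu i) (zeroˡ (u i)))

module Lines {q : ℕ} (F : FiniteField q) (n : ℕ) (N : ℕ → ℕ)
             (sub : (d : ℕ) → Fin (N d) → Lin.Pred F n) (E : Lin.IsEnumeration F n N sub) where

  open FieldFacts F
  open Lin F n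
  open Span F n

  direction : Fin (N 1) → Vec
  direction y = proj₁ (proj₁ (E 1) y) Fin.zero

  line⇔⟨direction⟩ : ∀ y v → sub 1 y v ⇔ ⟨ direction y ⟩ v
  line⇔⟨direction⟩ y v = let (_ , _ , spec) = proj₁ (E 1) y in
    ⇔.trans (mk⇔ (proj₁ (spec v)) (proj₂ (spec v))) (InSpan₁⇔⟨⟩ (proj₁ (proj₁ (E 1) y)) v)

  direction≢0 : ∀ y → ¬ direction y ≗ 0ᵛ
  direction≢0 y g≗0 = 0≢1 (sym (proj₁ (proj₂ (proj₁ (E 1) y)) (λ _ → 1#)
                        (λ i → trans (+-identityʳ _) (trans (*-identityˡ _) (g≗0 i))) Fin.zero))

  direction∈⟨⟩ : ∀ {w y} → ¬ w ≗ 0ᵛ → sub 1 y w → ⟨ w ⟩ (direction y)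
  direction∈⟨⟩ {w} {y} w≢0 w∈y with Equivalence.to (line⇔⟨direction⟩ y w) w∈y
  ... | κ , w≗κg = ⟨⟩-sym (coefficient≢0 w≢0 w≗κg) w≗κg

  line⊆line : ∀ {w y y′} → ¬ w ≗ 0ᵛ → sub 1 y w → sub 1 y′ w → sub 1 y ⊆ sub 1 y′
  line⊆line {w} {y} {y′} w≢0 w∈y w∈y′ v v∈y =
    Equivalence.from (line⇔⟨direction⟩ y′ v)
      (⟨⟩-trans (Equivalence.to (line⇔⟨direction⟩ y′ w) w∈y′) v
        (⟨⟩-trans (direction∈⟨⟩ w≢0 w∈y) v (Equivalence.to (line⇔⟨direction⟩ y v) v∈y)))

  line-unique : ∀ {w y y′} → ¬ w ≗ 0ᵛ → sub 1 y w → sub 1 y′ w → y ≡ y′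
  line-unique w≢0 w∈y w∈y′ = proj₁ (proj₂ (E 1)) _ _ (line⊆line w≢0 w∈y w∈y′ , line⊆line w≢0 w∈y′ w∈y)

  line-through : ∀ {w} → ¬ w ≗ 0ᵛ → ∃ λ y → sub 1 y w
  line-through {w} w≢0 with proj₂ (proj₂ (E 1)) _ (span-single-dim₁ w≢0)
  ... | y , ⟨w⟩≐y = y , proj₁ ⟨w⟩≐y w (Equivalence.from (InSpan₁⇔⟨⟩ (λ _ → w) w) (⟨⟩-refl w))

  -- Every nonzero vector is c · direction y for exactly one line y and one scalar c ≠ 0.
  ∑-multiples-of-directions : ∀ w →
    sum (λ y → ∑C (λ c → 𝟙 (¬? (c ≟ 0#)) * 𝟙 (w ≗? c · direction y))) ≡ 𝟙 (¬? (w ≗? 0ᵛ))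
  ∑-multiples-of-directions w with w ≗? 0ᵛ
  ... | yes w≗0 = trans
    (sum-zero _ (λ y → sum-zero _ (λ i → 𝟙-×-no (¬? (enum i ≟ 0#)) (w ≗? enum i · direction y)
      (λ c≢0 w≗cg → ·-≢0 c≢0 (direction≢0 y) (λ j → trans (sym (w≗cg j)) (w≗0 j))))))
    (sym (𝟙-no (¬? (w ≗? 0ᵛ)) (λ w≢0 → w≢0 w≗0)))
  ... | no w≢0 with line-through w≢0
  ...   | e , w∈e with Equivalence.to (line⇔⟨direction⟩ e w) w∈e
  ...     | κ , w≗κg = begin
    sum (λ y → ∑C (λ c → f y c)) ≡⟨ sum-single _ e (λ y y≢e → sum-zero _ (λ i → off-line y y≢e (enum i))) ⟩
    ∑C (λ c → f e c)             ≡⟨ ∑C-single (f e) κ off-κ ⟩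
    f e κ                        ≡⟨ cong₂ _*_ (𝟙-yes (¬? (κ ≟ 0#)) κ≢0) (𝟙-yes (w ≗? κ · direction e) w≗κg) ⟩
    1ℤ                           ≡⟨ 𝟙-yes (¬? (w ≗? 0ᵛ)) w≢0 ⟨
    𝟙 (¬? (w ≗? 0ᵛ))            ∎
    where
    open ≡-Reasoning
    f : Fin (N 1) → Carrier → ℤ
    f y c = 𝟙 (¬? (c ≟ 0#)) * 𝟙 (w ≗? c · direction y)
    κ≢0 = coefficient≢0 w≢0 w≗κg
    off-line : ∀ y → y ≢ e → ∀ c → f y c ≡ 0ℤ
    off-line y y≢e c = 𝟙-×-no (¬? (c ≟ 0#)) (w ≗? c · direction y)
      (λ _ w≗cg → y≢e (line-unique w≢0 (Equivalence.from (line⇔⟨direction⟩ y w) (c , w≗cg)) w∈e))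
    off-κ : ∀ c → c ≢ κ → f e c ≡ 0ℤ
    off-κ c c≢κ = 𝟙-×-no (¬? (c ≟ 0#)) (w ≗? c · direction e)
      (λ _ w≗cg → c≢κ (·-cancelʳ (direction≢0 e) (λ i → trans (sym (w≗cg i)) (w≗κg i))))

  ∑V-preimages : ∀ {d} {β : Fin d → Vec} → Independent β → ∀ w →
                 ∑V d (λ a → 𝟙 (lincomb β a ≗? w)) ≡ 𝟙 (inSpan? β w)
  ∑V-preimages {d} {β} β-indep w with inSpan? β w
  ... | yes (a₀ , w≗βa₀) = trans (∑V-cong d (λ a → 𝟙-cong (lincomb β a ≗? w) (a ≗? a₀)
                             (mk⇔ (λ βa≗w → lincomb-injective β-indep (λ i → trans (βa≗w i) (w≗βa₀ i)))
                                  (λ a≗a₀ i → trans (lincomb-cong β a≗a₀ i) (sym (w≗βa₀ i))))))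
                                 (∑V-δ d a₀)
  ... | no w∉β = ∑V-zero d _ (λ a → 𝟙-no (lincomb β a ≗? w) (λ βa≗w → w∉β (a , λ i → sym (βa≗w i))))

  module _ {d} {β : Fin d → Vec} (β-indep : Independent β) where

    private
      L : ℤ
      L = sum (λ y → 𝟙 (inSpan? β (direction y)))

    nonzero-vectors-in-span : ∑V d (λ a → 𝟙 (¬? (lincomb β a ≗? 0ᵛ))) ≡ + (q ^ d) - 1ℤ
    nonzero-vectors-in-span = begin
      ∑V d (λ a → 𝟙 (¬? (lincomb β a ≗? 0ᵛ)))             ≡⟨ ∑V-cong d (λ a → 𝟙-¬ (lincomb β a ≗? 0ᵛ)) ⟩
      ∑V d (λ a → 1ℤ - 𝟙 (lincomb β a ≗? 0ᵛ))            ≡⟨ ∑V-sub d _ _ ⟩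
      ∑V d (λ _ → 1ℤ) - ∑V d (λ a → 𝟙 (lincomb β a ≗? 0ᵛ)) ≡⟨ cong₂ _-_ (∑V-1 d) (∑V-preimages β-indep 0ᵛ) ⟩
      + (q ^ d) - 𝟙 (inSpan? β 0ᵛ)                        ≡⟨ cong (λ z → + (q ^ d) - z) (𝟙-yes (inSpan? β 0ᵛ) 0∈span) ⟩
      + (q ^ d) - 1ℤ                                      ∎
      where
      open ≡-Reasoning
      0∈span : InSpan β 0ᵛ
      0∈span = (λ _ → 0#) , λ i → sym (lincomb-0 β i)

    nonzero-vectors-by-line : ∑V d (λ a → 𝟙 (¬? (lincomb β a ≗? 0ᵛ))) ≡ (+ q - 1ℤ) * L
    nonzero-vectors-by-line = begin
      ∑V d (λ a → 𝟙 (¬? (lincomb β a ≗? 0ᵛ)))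
        ≡⟨ ∑V-cong d (λ a → ∑-multiples-of-directions (lincomb β a)) ⟨
      ∑V d (λ a → sum (λ y → ∑C (λ c → f a y c)))
        ≡⟨ ∑V-comm d (λ a y → ∑C (λ c → f a y c)) ⟩
      sum (λ y → ∑V d (λ a → ∑C (λ c → f a y c)))
        ≡⟨ sum-cong-≗ {N 1} (λ y → ∑V-comm d (λ a i → f a y (enum i))) ⟩
      sum (λ y → ∑C (λ c → ∑V d (λ a → f a y c)))
        ≡⟨ sum-cong-≗ {N 1} (λ y → ∑C-cong (λ c →
             trans (∑V-*ˡ d (𝟙 (¬? (c ≟ 0#))) (λ a → 𝟙 (lincomb β a ≗? c · direction y)))
                   (cong (𝟙 (¬? (c ≟ 0#)) *_) (∑V-preimages β-indep _)))) ⟩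
      sum (λ y → ∑C (λ c → 𝟙 (¬? (c ≟ 0#)) * 𝟙 (inSpan? β (c · direction y))))
        ≡⟨ sum-cong-≗ {N 1} (λ y → ∑C-cong (λ c →
             𝟙-*-congʳ (¬? (c ≟ 0#)) (inSpan? β (c · direction y)) (inSpan? β (direction y)) (scaling c y))) ⟩
      sum (λ y → ∑C (λ c → 𝟙 (¬? (c ≟ 0#)) * 𝟙 (inSpan? β (direction y))))
        ≡⟨ sum-cong-≗ {N 1} (λ y →
             trans (sym (*-distribʳ-sum (𝟙 (inSpan? β (direction y))) (λ i → 𝟙 (¬? (enum i ≟ 0#)))))
                   (cong (_* 𝟙 (inSpan? β (direction y))) ∑C-≢0)) ⟩
      sum (λ y → (+ q - 1ℤ) * 𝟙 (inSpan? β (direction y)))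
        ≡⟨ *-distribˡ-sum (+ q - 1ℤ) (λ y → 𝟙 (inSpan? β (direction y))) ⟨
      (+ q - 1ℤ) * L                                     ∎
      where
      open ≡-Reasoning
      f : Coords d → Fin (N 1) → Carrier → ℤ
      f a y c = 𝟙 (¬? (c ≟ 0#)) * 𝟙 (lincomb β a ≗? c · direction y)
      scaling : ∀ c y → ¬ c ≡ 0# → InSpan β (c · direction y) ⇔ InSpan β (direction y)
      scaling c y c≢0 = mk⇔ (λ h → InSpan-⟨⟩ β h (⟨⟩-sym c≢0 (λ _ → refl))) (λ h → InSpan-⟨⟩ β h (c , λ _ → refl))

    count-lines-in-span : sum (λ y → 𝟙 (inSpan? β (direction y))) ≡ + qint q d
    count-lines-in-span = ℤ.*-cancelˡ-≡ (+ q - 1ℤ) L (+ qint q d) {{≢-nonZero q-1≢0}}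
      (trans (sym nonzero-vectors-by-line) (trans nonzero-vectors-in-span (sym ([q-1]*qint≡q^-1 q d))))
      where
      q-1≢0 : + q - 1ℤ ≢ 0ℤ
      q-1≢0 q-1≡0 = q≢1 (ℤ.+-injective (ℤ.i-j≡0⇒i≡j (+ q) 1ℤ q-1≡0))

  line⊆⇔ : ∀ {W d} ((β , _ , W≐span) : HasDim W d) y → sub 1 y ⊆ W ⇔ InSpan β (direction y)
  line⊆⇔ {W} (β , _ , W≐span) y = mk⇔
    (λ y⊆W → proj₁ (W≐span _) (y⊆W _ (Equivalence.from (line⇔⟨direction⟩ y _) (⟨⟩-refl _))))
    (λ g∈span v v∈y → proj₂ (W≐span v) (InSpan-⟨⟩ β g∈span (Equivalence.to (line⇔⟨direction⟩ y v) v∈y)))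

  lines-in? : ∀ {W d} → HasDim W d → ∀ y → Dec (sub 1 y ⊆ W)
  lines-in? W-dim y = map′ (Equivalence.from (line⊆⇔ W-dim y)) (Equivalence.to (line⊆⇔ W-dim y)) (inSpan? (proj₁ W-dim) (direction y))

  count-lines : ∀ {W d} → HasDim W d → (u : Fin (N 1) → Bool) → (∀ y → u y ≡ true ⇔ sub 1 y ⊆ W) →
                Σℤ (N 1) (λ y → ⟦ u y ⟧) ≡ + qint q d
  count-lines {d = d} W-dim@(β , β-indep , _) u u⇔⊆ = begin
    Σℤ (N 1) (λ y → ⟦ u y ⟧)                   ≡⟨ Σℤ≡sum (N 1) (λ y → ⟦ u y ⟧) ⟩
    sum (λ y → ⟦ u y ⟧)                        ≡⟨ sum-cong-≗ (λ y →
                                                    ⟦⟧≡𝟙 (u y) (inSpan? β (direction y)) (⇔.trans (u⇔⊆ y) (line⊆⇔ W-dim y))) ⟩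
    sum (λ y → 𝟙 (inSpan? β (direction y)))    ≡⟨ count-lines-in-span β-indep ⟩
    + qint q d                                 ∎
    where open ≡-Reasoning

lineLevel : ∀ N s → (Fin (N 1) → Bool) → Ω N s
lineLevel N zero    u _                     _ = false
lineLevel N (suc s) u Fin.zero              _ = false
lineLevel N (suc s) u (Fin.suc Fin.zero)    y = u y
lineLevel N (suc s) u (Fin.suc (Fin.suc _)) _ = false

lineLevel-off : ∀ N s u (x : Fin (suc s)) y → toℕ x ≢ 1 → lineLevel N s u x y ≡ false
lineLevel-off N zero    u Fin.zero              y _   = refl
lineLevel-off N (suc s) u Fin.zero              y _   = refl
lineLevel-off N (suc s) u (Fin.suc Fin.zero)    y x≢1 = ⊥-elim (x≢1 refl)
lineLevel-off N (suc s) u (Fin.suc (Fin.suc _)) y _   = refl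

switchOn : ∀ N {s} → Ω N s → (x : Fin (suc s)) → Fin (N (toℕ x)) → Ω N s
switchOn N v x y x′ y′ with x′ Fin.≟ x
... | yes refl = does (y′ Fin.≟ y) ∨ v x′ y′
... | no _     = v x′ y′

switchOn-≢ : ∀ N {s} (v : Ω N s) x y x′ y′ → x′ ≢ x → switchOn N v x y x′ y′ ≡ v x′ y′
switchOn-≢ N v x y x′ y′ x′≢x with x′ Fin.≟ x
... | yes refl = ⊥-elim (x′≢x refl)
... | no _     = refl

switchOn-≡ : ∀ N {s} (v : Ω N s) x y y′ → switchOn N v x y x y′ ≡ does (y′ Fin.≟ y) ∨ v x y′
switchOn-≡ N v x y y′ with x Fin.≟ x
... | yes refl = refl
... | no x≢x   = ⊥-elim (x≢x refl)

ones-switchOn : ∀ N s (v : Ω N s) x y → toℕ x ≢ 1 → ones N s (switchOn N v x y) ≗ ones N s v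
ones-switchOn N zero    v x y x≢1 y′ = refl
ones-switchOn N (suc s) v x y x≢1 y′ = switchOn-≢ N v x y (Fin.suc Fin.zero) y′ (λ 1≡x → x≢1 (cong toℕ (sym 1≡x)))

gi-lineLevel : ∀ q N s (μ : Fin s → ℕ) (w u : Fin (N 1) → Bool) →
               gi q N s μ w (lineLevel N s u) ≡ Πℤ s (λ t → Σℤ (N 1) (λ y → ⟦ w y ∧ u y ⟧) - + qint q (μ t))
gi-lineLevel q N zero    μ w u = refl
gi-lineLevel q N (suc s) μ w u =
  Πℤ-cong (suc s) (λ t → cong (_- + qint q (μ t)) (Σℤ-cong (N 1) (λ y → ⟦⟧-∧ (w y) (u y))))

Σones-lineLevel : ∀ q N s u (x : Fin (suc s)) → Σℤ (N 1) (λ y → ⟦ u y ⟧) ≡ + qint q (toℕ x) →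
                  Σℤ (N 1) (λ y → ⟦ ones N s (lineLevel N s u) y ⟧) ≡ + qint q (toℕ x)
Σones-lineLevel q N zero    u Fin.zero Σu≡[x] = Σℤ-zero (N 1) _ (λ _ → refl)
Σones-lineLevel q N (suc s) u x        Σu≡[x] = Σu≡[x]

module Levels (q : ℕ) (N : ℕ → ℕ) (r : ℕ) (k : Fin r → ℕ) where

  -- gxy q N s r k x y v unfolds to ⟦ v x y ⟧ * levelFactor (ones N s v).
  levelFactor : (Fin (N 1) → Bool) → ℤ
  levelFactor o = Πℤ r (λ t → Σℤ (N 1) (λ y → ⟦ o y ⟧) - + qint q (k t))

  levelFactor-cong : ∀ {o o′} → o ≗ o′ → levelFactor o ≡ levelFactor o′
  levelFactor-cong o≗o′ = Πℤ-cong r (λ t → cong (_- + qint q (k t)) (Σℤ-cong (N 1) (λ y → cong ⟦_⟧ (o≗o′ y))))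

  levelPart : ∀ s → ((x : Fin (suc s)) → Fin (N (toℕ x)) → ℤ) → Ω N s → ℤ
  levelPart s c′ v = Σℤ (suc s) (λ x → Σℤ (N (toℕ x)) (λ y → c′ x y * gxy q N s r k x y v))

  ∣gxy-lineLevel : ∀ {d} s u (x : Fin (suc s)) y → (Fin s → d ∣ levelFactor u) → d ∣ gxy q N s r k x y (lineLevel N s u)
  ∣gxy-lineLevel zero    u x                     y _     = divides 0ℤ refl
  ∣gxy-lineLevel (suc s) u Fin.zero              y _     = divides 0ℤ refl
  ∣gxy-lineLevel (suc s) u (Fin.suc Fin.zero)    y d∣LF  = ∣n⇒∣m*n ⟦ u y ⟧ (d∣LF Fin.zero)
  ∣gxy-lineLevel (suc s) u (Fin.suc (Fin.suc x)) y _     = divides 0ℤ refl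

  levelPart-switchOn : ∀ s c′ (v : Ω N s) x y → toℕ x ≢ 1 → v x y ≡ false →
                       levelPart s c′ (switchOn N v x y) - levelPart s c′ v ≡ c′ x y * levelFactor (ones N s v)
  levelPart-switchOn s c′ v x y x≢1 vxy≡false = begin
    levelPart s c′ v₁ - levelPart s c′ v
      ≡⟨ Σℤ-sub-single (suc s) _ _ x other-level ⟩
    Σℤ (N (toℕ x)) (λ y′ → c′ x y′ * g v₁ y′) - Σℤ (N (toℕ x)) (λ y′ → c′ x y′ * g v y′)
      ≡⟨ Σℤ-sub-single (N (toℕ x)) _ _ y other-line ⟩
    c′ x y * g v₁ y - c′ x y * g v y
      ≡⟨ cong₂ (λ a b → c′ x y * a - c′ x y * b) (cong₂ (λ a b → ⟦ a ⟧ * b) v₁xy≡true LF₁≡LF)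
                                                   (cong (λ a → ⟦ a ⟧ * LF) vxy≡false) ⟩
    c′ x y * (1ℤ * LF) - c′ x y * (0ℤ * LF)
      ≡⟨ simplify (c′ x y) LF ⟩
    c′ x y * LF
      ∎
    where
    open ≡-Reasoning
    v₁ = switchOn N v x y
    LF = levelFactor (ones N s v)
    g : Ω N s → Fin (N (toℕ x)) → ℤ
    g w y′ = gxy q N s r k x y′ w
    simplify : ∀ a b → a * (1ℤ * b) - a * (0ℤ * b) ≡ a * b
    simplify = solve-∀
    LF₁≡LF : levelFactor (ones N s v₁) ≡ LF
    LF₁≡LF = levelFactor-cong (ones-switchOn N s v x y x≢1)
    other-level : ∀ x′ → x′ ≢ x → Σℤ (N (toℕ x′)) (λ y′ → c′ x′ y′ * gxy q N s r k x′ y′ v₁)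
                                 ≡ Σℤ (N (toℕ x′)) (λ y′ → c′ x′ y′ * gxy q N s r k x′ y′ v)
    other-level x′ x′≢x = Σℤ-cong (N (toℕ x′)) (λ y′ →
      cong (c′ x′ y′ *_) (cong₂ (λ a b → ⟦ a ⟧ * b) (switchOn-≢ N v x y x′ y′ x′≢x) LF₁≡LF))
    switched-on : ∀ y′ → switchOn N v x y x y′ ≡ does (y′ Fin.≟ y) ∨ v x y′
    switched-on = switchOn-≡ N v x y
    v₁xy≡true : v₁ x y ≡ true
    v₁xy≡true = trans (switched-on y) (cong (_∨ v x y) (dec-true (y Fin.≟ y) refl))
    other-line : ∀ y′ → y′ ≢ y → c′ x y′ * g v₁ y′ ≡ c′ x y′ * g v y′
    other-line y′ y′≢y = cong (c′ x y′ *_) (cong₂ (λ a b → ⟦ a ⟧ * b)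
      (trans (switched-on y′) (cong (_∨ v x y′) (dec-false (y′ Fin.≟ y) y′≢y))) LF₁≡LF)

  δ : ∀ {ℓ} → Fin ℓ → Fin ℓ → Bool
  δ y y′ = does (y′ Fin.≟ y)

  levelPart-lineLevel-δ : ∀ s c′ y →
                          levelPart (suc s) c′ (lineLevel N (suc s) (δ y)) ≡ c′ (Fin.suc Fin.zero) y * levelFactor (δ y)
  levelPart-lineLevel-δ s c′ y = begin
    levelPart (suc s) c′ v                          ≡⟨ Σℤ-single (suc (suc s)) _ x₁ other-level ⟩
    Σℤ (N 1) (λ y′ → c′ x₁ y′ * (⟦ δ y y′ ⟧ * LF))  ≡⟨ Σℤ-single (N 1) _ y other-line ⟩
    c′ x₁ y * (⟦ δ y y ⟧ * LF)                      ≡⟨ cong (λ a → c′ x₁ y * (⟦ a ⟧ * LF)) (dec-true (y Fin.≟ y) refl) ⟩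
    c′ x₁ y * (1ℤ * LF)                             ≡⟨ cong (c′ x₁ y *_) (ℤ.*-identityˡ LF) ⟩
    c′ x₁ y * LF                                    ∎
    where
    open ≡-Reasoning
    x₁ : Fin (suc (suc s))
    x₁ = Fin.suc Fin.zero
    v = lineLevel N (suc s) (δ y)
    LF = levelFactor (δ y)
    vanish : ∀ a b → a * (0ℤ * b) ≡ 0ℤ
    vanish = solve-∀
    other-level : ∀ x → x ≢ x₁ → Σℤ (N (toℕ x)) (λ y′ → c′ x y′ * gxy q N (suc s) r k x y′ v) ≡ 0ℤ
    other-level x x≢x₁ = Σℤ-zero (N (toℕ x)) _ (λ y′ → trans
      (cong (λ a → c′ x y′ * (⟦ a ⟧ * LF)) (lineLevel-off N (suc s) (δ y) x y′ (λ x≡1 → x≢x₁ (Fin.toℕ-injective x≡1))))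
      (vanish (c′ x y′) LF))
    other-line : ∀ y′ → y′ ≢ y → c′ x₁ y′ * (⟦ δ y y′ ⟧ * LF) ≡ 0ℤ
    other-line y′ y′≢y =
      trans (cong (λ a → c′ x₁ y′ * (⟦ a ⟧ * LF)) (dec-false (y′ Fin.≟ y) y′≢y)) (vanish (c′ x₁ y′) LF)

module Coefficients
  {q : ℕ} (F : FiniteField q) (n b : ℕ) (0<b : 0 < b) (r : ℕ) (k : Fin r → ℕ)
  (p : ℕ) (p-prime : Prime p) (q^b≡1 : Cong (q ^ b) 1 p) (q^i≢1 : ∀ i → 0 < i → i < b → ¬ Cong (q ^ i) 1 p)
  (N : ℕ → ℕ) (sub : (d : ℕ) → Fin (N d) → Lin.Pred F n) (E : Lin.IsEnumeration F n N sub) where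

  open Residues q p b p-prime 0<b q^b≡1 q^i≢1
  open Lines F n N sub E
  open Levels q N r k

  p∤levelFactor : ∀ {a} (o : Fin (N 1) → Bool) → (∀ t → ¬ Cong a (k t) b) →
                  Σℤ (N 1) (λ y → ⟦ o y ⟧) ≡ [ a ] → ¬ p∣ levelFactor o
  p∤levelFactor {a} o a≢k Σo≡[a] = p∤Πℤ r _ (λ t p∣[a]-[k] →
    a≢k t (Equivalence.to (p∣[a]-[a′]⇔Cong (¬Cong⇒2≤ {a} {k t} 0<b (a≢k t)) a (k t))
                          (subst (λ z → p∣ z - [ k t ]) Σo≡[a] p∣[a]-[k])))

  module _ (s : ℕ) (c′ : (x : Fin (suc s)) → Fin (N (toℕ x)) → ℤ) (p∣B : ∀ v → p∣ levelPart s c′ v) where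

    c′-divisible-x≢1 : ∀ x y → toℕ x ≢ 1 → (∀ t → ¬ Cong (toℕ x) (k t) b) → p∣ c′ x y
    c′-divisible-x≢1 x y x≢1 x≢k = Equivalence.to (p∣-cancelʳ (p∤levelFactor (ones N s v₀) x≢k Σones≡[x]))
      (subst p∣_ (levelPart-switchOn s c′ v₀ x y x≢1 (lineLevel-off N s u x y x≢1))
                 (∣m∣n⇒∣m-n (p∣B (switchOn N v₀ x y)) (p∣B v₀)))
      where
      W-dim = proj₁ (E (toℕ x)) y
      u : Fin (N 1) → Bool
      u y′ = does (lines-in? W-dim y′)
      v₀ = lineLevel N s u
      Σones≡[x] : Σℤ (N 1) (λ y′ → ⟦ ones N s v₀ y′ ⟧) ≡ [ toℕ x ]
      Σones≡[x] = Σones-lineLevel q N s u x (count-lines W-dim u (λ y′ → does-⇔ (lines-in? W-dim y′)))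

  c′-divisible-x≡1 : ∀ s c′ → (∀ v → p∣ levelPart (suc s) c′ v) →
                           ∀ y → (∀ t → ¬ Cong 1 (k t) b) → p∣ c′ (Fin.suc Fin.zero) y
  c′-divisible-x≡1 s c′ p∣B y 1≢k = Equivalence.to (p∣-cancelʳ (p∤levelFactor (δ y) 1≢k Σδ≡1))
    (subst p∣_ (levelPart-lineLevel-δ s c′ y) (p∣B (lineLevel N (suc s) (δ y))))
    where
    Σδ≡1 : Σℤ (N 1) (λ y′ → ⟦ δ y y′ ⟧) ≡ 1ℤ
    Σδ≡1 = trans (Σℤ-single (N 1) _ y (λ y′ y′≢y → cong ⟦_⟧ (dec-false (y′ Fin.≟ y) y′≢y)))
                 (cong ⟦_⟧ (dec-true (y Fin.≟ y) refl))

  c′-divisible : ∀ s c′ → (∀ v → p∣ levelPart s c′ v) → ∀ x y → (∀ t → ¬ Cong (toℕ x) (k t) b) → p∣ c′ x y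
  c′-divisible zero    c′ p∣B Fin.zero              y = c′-divisible-x≢1 zero c′ p∣B Fin.zero y (λ ())
  c′-divisible (suc s) c′ p∣B Fin.zero              y = c′-divisible-x≢1 (suc s) c′ p∣B Fin.zero y (λ ())
  c′-divisible (suc s) c′ p∣B (Fin.suc Fin.zero)    y = c′-divisible-x≡1 s c′ p∣B y
  c′-divisible (suc s) c′ p∣B (Fin.suc (Fin.suc x)) y = c′-divisible-x≢1 (suc s) c′ p∣B (Fin.suc (Fin.suc x)) y (λ ())

  module Family
    (s : ℕ) (μ : Fin s → ℕ) (k<b : ∀ t → k t < b) (μ<b : ∀ j → μ j < b) (k≢μ : ∀ t j → k t ≢ μ j)
    (m : ℕ) (V : Fin m → Lin.Pred F n)
    (V-dim : ∀ i → ∃ λ d → Lin.HasDim F n (V i) d × ∃ λ t → Cong d (k t) b)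
    (V∩V-dim : ∀ i j → i ≢ j → ∃ λ d → Lin.HasDim F n (Lin._∩_ F n (V i) (V j)) d × ∃ λ t → Cong d (μ t) b)
    (cont : Fin m → Fin (N 1) → Bool)
    (cont⇔ : ∀ i y → cont i y ≡ true ⇔ Lin._⊆_ F n (sub 1 y) (V i))
    (c : Fin m → ℤ) (c′ : (x : Fin (suc s)) → Fin (N (toℕ x)) → ℤ)
    (p∣combination : ∀ v → p∣ Σℤ m (λ i → c i * gi q N s μ (cont i) v) + levelPart s c′ v) where

    open Lin F n using (_⊆_; _∩_)

    familyPart : Ω N s → ℤ
    familyPart v = Σℤ m (λ i → c i * gi q N s μ (cont i) v)

    k≢μ-mod-b : ∀ t j → ¬ Cong (k t) (μ j) b
    k≢μ-mod-b t j k≡μ = k≢μ t j (Cong-<⇒≡ (k<b t) (μ<b j) k≡μ)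

    2≤b : Fin r → Fin s → 2 ≤ b
    2≤b t j = ¬Cong⇒2≤ {k t} {μ j} 0<b (k≢μ-mod-b t j)

    cont∧⇔ : ∀ i j y → cont i y ∧ cont j y ≡ true ⇔ sub 1 y ⊆ (V i ∩ V j)
    cont∧⇔ i j y = ⇔.trans ∧≡true⇔ (mk⇔
      (λ (i∋y , j∋y) w w∈y → Equivalence.to (cont⇔ i y) i∋y w w∈y , Equivalence.to (cont⇔ j y) j∋y w w∈y)
      (λ y⊆∩ → Equivalence.from (cont⇔ i y) (λ w w∈y → proj₁ (y⊆∩ w w∈y)) ,
               Equivalence.from (cont⇔ j y) (λ w w∈y → proj₂ (y⊆∩ w w∈y))))

    module _ (j : Fin m) where

      private
        d = proj₁ (V-dim j)
        tʲ = proj₁ (proj₂ (proj₂ (V-dim j)))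
        v = lineLevel N s (cont j)

        Σcont≡[d] : Σℤ (N 1) (λ y → ⟦ cont j y ⟧) ≡ [ d ]
        Σcont≡[d] = count-lines (proj₁ (proj₂ (V-dim j))) (cont j) (cont⇔ j)

        p∣[d]-[k] : Fin s → p∣ [ d ] - [ k tʲ ]
        p∣[d]-[k] t = Equivalence.from (p∣[a]-[a′]⇔Cong (2≤b tʲ t) d (k tʲ)) (proj₂ (proj₂ (proj₂ (V-dim j))))

      p∣levelPart-at-cont : p∣ levelPart s c′ v
      p∣levelPart-at-cont = ∣Σℤ (suc s) _ (λ x → ∣Σℤ (N (toℕ x)) _ (λ y → ∣n⇒∣m*n (c′ x y)
        (∣gxy-lineLevel s (cont j) x y (λ t → ∣Πℤ r _ tʲ (subst (λ z → p∣ z - [ k tʲ ]) (sym Σcont≡[d]) (p∣[d]-[k] t))))))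

      p∣gi-at-cont : ∀ i → i ≢ j → p∣ gi q N s μ (cont i) v
      p∣gi-at-cont i i≢j = let (d′ , ∩-dim , t , d′≡μ) = V∩V-dim i j i≢j in
        subst p∣_ (sym (gi-lineLevel q N s μ (cont i) (cont j))) (∣Πℤ s _ t
          (subst (λ z → p∣ z - [ μ t ]) (sym (count-lines ∩-dim (λ y → cont i y ∧ cont j y) (cont∧⇔ i j)))
            (Equivalence.from (p∣[a]-[a′]⇔Cong (2≤b tʲ t) d′ (μ t)) d′≡μ)))

      p∤gi-at-own-cont : ¬ p∣ gi q N s μ (cont j) v
      p∤gi-at-own-cont p∣g = p∤Πℤ s _ p∤factor (subst p∣_ (gi-lineLevel q N s μ (cont j) (cont j)) p∣g)
        where
        shift : ∀ x y z → (x - z) - (x - y) ≡ y - z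
        shift = solve-∀
        Σcont∧cont≡[d] : Σℤ (N 1) (λ y → ⟦ cont j y ∧ cont j y ⟧) ≡ [ d ]
        Σcont∧cont≡[d] = trans (Σℤ-cong (N 1) (λ y → cong ⟦_⟧ (∧-idem (cont j y)))) Σcont≡[d]
        p∤factor : ∀ t → ¬ p∣ Σℤ (N 1) (λ y → ⟦ cont j y ∧ cont j y ⟧) - [ μ t ]
        p∤factor t p∣[d]-[μ] = k≢μ-mod-b tʲ t (Equivalence.to (p∣[a]-[a′]⇔Cong (2≤b tʲ t) (k tʲ) (μ t))
          (subst p∣_ (shift [ d ] [ k tʲ ] [ μ t ])
            (∣m∣n⇒∣m-n (subst (λ z → p∣ z - [ μ t ]) Σcont∧cont≡[d] p∣[d]-[μ]) (p∣[d]-[k] t))))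

      c-divisible : p∣ c j
      c-divisible = Equivalence.to (p∣-cancelʳ p∤gi-at-own-cont) (subst p∣_ (cancel (familyPart v) _)
        (∣m∣n⇒∣m-n (∣m+n∣n⇒∣m {m = familyPart v} (p∣combination v) p∣levelPart-at-cont)
                   (∣Σℤ-except m _ j (λ i i≢j → ∣n⇒∣m*n (c i) (p∣gi-at-cont i i≢j)))))
        where
        cancel : ∀ x y → x - (x - y) ≡ y
        cancel = solve-∀

    p∣levelPart : ∀ v → p∣ levelPart s c′ v
    p∣levelPart v = ∣m+n∣m⇒∣n (p∣combination v) (∣Σℤ m _ (λ i → ∣m⇒∣m*n _ (c-divisible i)))

mainTheorem10 :
    ∀ (q : ℕ) (F : FiniteField q) (n b : ℕ) → 0 < b →
    ∀ (r s : ℕ) (k : Fin r → ℕ) (μ : Fin s → ℕ) →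
    (∀ t t′ → t Fin.< t′ → k t < k t′) →
    (∀ t → k t < b) →
    (∀ j → μ j < b) →
    (∀ j j′ → μ j ≡ μ j′ → j ≡ j′) →
    (∀ t j → k t ≢ μ j) →
    ¬ ((∃ λ e → q ℕ.+ 1 ≡ 2 ^ e) × b ≡ 2) →
    ¬ (q ≡ 2 × b ≡ 6) →
    ∀ (p : ℕ) → Prime p →
    Cong (q ^ b) 1 p →
    (∀ i → 0 < i → i < b → ¬ Cong (q ^ i) 1 p) →
    ∀ (N : ℕ → ℕ) (sub : (d : ℕ) → Fin (N d) → Lin.Pred F n) →
    Lin.IsEnumeration F n N sub →
    ∀ (m : ℕ) (V : Fin m → Lin.Pred F n) →
    (∀ i → ∃ λ d → Lin.HasDim F n (V i) d × ∃ λ t → Cong d (k t) b) →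
    (∀ i j → i ≢ j →
      ∃ λ d → Lin.HasDim F n (Lin._∩_ F n (V i) (V j)) d × ∃ λ t → Cong d (μ t) b) →
    ∀ (cont : Fin m → Fin (N 1) → Bool) →
    (∀ i y → (cont i y ≡ true → Lin._⊆_ F n (sub 1 y) (V i))
           × (Lin._⊆_ F n (sub 1 y) (V i) → cont i y ≡ true)) →
    ∀ (c : Fin m → ℤ) (c′ : (x : Fin (suc s)) → Fin (N (toℕ x)) → ℤ) →
    (∀ x y → ¬ (toℕ x ℕ.+ r ≤ s × (∀ t → ¬ Cong (toℕ x) (k t) b)) → c′ x y ≡ + 0) →
    (∀ (v : Ω N s) →
      (+ p) ℤ∣.∣ (Σℤ m (λ i → c i * gi q N s μ (cont i) v)
               + Σℤ (suc s) (λ x → Σℤ (N (toℕ x)) (λ y → c′ x y * gxy q N s r k x y v)))) →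
    (∀ i → (+ p) ℤ∣.∣ c i) × (∀ x y → (+ p) ℤ∣.∣ c′ x y)
mainTheorem10 q F n b 0<b r s k μ _ k<b μ<b _ k≢μ _ _ p p-prime q^b≡1 q^i≢1 N sub E m V V-dim V∩V-dim
              cont cont-spec c c′ c′-vanishes p∣combination =
  (λ i → ∣⇒∣ᵤ (c-divisible i)) , (λ x y → ∣⇒∣ᵤ (p∣c′ x y))
  where
  open Residues q p b p-prime 0<b q^b≡1 q^i≢1 using (p∣_)
  open Coefficients F n b 0<b r k p p-prime q^b≡1 q^i≢1 N sub E
  open Family s μ k<b μ<b k≢μ m V V-dim V∩V-dim cont (λ i y → mk⇔ (proj₁ (cont-spec i y)) (proj₂ (cont-spec i y)))
              c c′ (λ v → ∣ᵤ⇒∣ (p∣combination v))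
  p∣c′ : ∀ x y → p∣ c′ x y
  p∣c′ x y with Fin.all? (λ t → ¬? (Cong? (toℕ x) (k t) b))
  ... | yes x≢k = c′-divisible s c′ p∣levelPart x y x≢k
  ... | no ¬x≢k = subst p∣_ (sym (c′-vanishes x y (λ (_ , x≢k) → ¬x≢k x≢k))) (divides 0ℤ refl)
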